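{- Let $\Gamma$ be a bipartite graph and $H$ an abelian semiregular subgroup of $\mathrm{Aut}(\Gamma)$ whose orbits are exactly the two bipartite sets of $\Gamma$. Then $\Gamma$ is a Cayley graph on the generalized dihedral group $GD_H$.
   Context: Graphs are finite and simple. For an abelian group $H$, the generalized dihedral group $GD_H$ is the semidirect product $H\rtimes\mathbb{Z}_2$ in which the involution of $\mathbb{Z}_2$ inverts every element of $H$. A graph is a Cayley graph on a group $G$ if it is isomorphic to $\mathrm{Cay}(G,S)$ (vertex set $G$, edges $\{g,sg\}$) for some $S\subseteq G$ with $1\notin S=S^{ -1}$; equivalently its automorphism group contains a subgroup isomorphic to $G$ acting regularly on vertices. -}

module Defs where

open import Data.Nat using (ℕ)
open import Data.Fin using (Fin)
open import Data.Bool using (Bool; true; false; if_then_else_; _xor_)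
open import Data.Product using (Σ; _×_; _,_; ∃)
open import Data.Sum using (_⊎_)
open import Relation.Nullary using (¬_)
open import Relation.Binary.PropositionalEquality using (_≡_)

record Graph (n : ℕ) : Set where
  field
    adj    : Fin n → Fin n → Bool
    sym    : ∀ x y → adj x y ≡ adj y x
    irrefl : ∀ x → adj x x ≡ false

record Perm (n : ℕ) : Set where
  field
    fwd   : Fin n → Fin n
    bwd   : Fin n → Fin n
    left  : ∀ x → bwd (fwd x) ≡ x
    right : ∀ x → fwd (bwd x) ≡ x
open Perm public

_≈ₚ_ : ∀ {n} → Perm n → Perm n → Set
p ≈ₚ q = ∀ x → fwd p x ≡ fwd q x

idₚ : ∀ {n} → Perm n
idₚ = record { fwd = λ x → x ; bwd = λ x → x
             ; left = λ x → Relation.Binary.PropositionalEquality.refl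
             ; right = λ x → Relation.Binary.PropositionalEquality.refl }

_∘ₚ_ : ∀ {n} → Perm n → Perm n → Perm n
p ∘ₚ q = record
  { fwd = λ x → fwd p (fwd q x)
  ; bwd = λ x → bwd q (bwd p x)
  ; left = λ x → Relation.Binary.PropositionalEquality.trans
                   (Relation.Binary.PropositionalEquality.cong (bwd q) (left p (fwd q x)))
                   (left q x)
  ; right = λ x → Relation.Binary.PropositionalEquality.trans
                   (Relation.Binary.PropositionalEquality.cong (fwd p) (right q (bwd p x)))
                   (right p x)
  }

_⁻¹ₚ : ∀ {n} → Perm n → Perm n
p ⁻¹ₚ = record { fwd = bwd p ; bwd = fwd p ; left = right p ; right = left p }

IsAut : ∀ {n} → Graph n → Perm n → Set
IsAut Γ p = ∀ x y → Graph.adj Γ (fwd p x) (fwd p y) ≡ Graph.adj Γ x y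

record AutSubgroup {n : ℕ} (Γ : Graph n) : Set₁ where
  field
    mem      : Perm n → Set
    mem-resp : ∀ {p q} → p ≈ₚ q → mem p → mem q
    mem-aut  : ∀ {p} → mem p → IsAut Γ p
    mem-id   : mem idₚ
    mem-∘    : ∀ {p q} → mem p → mem q → mem (p ∘ₚ q)
    mem-inv  : ∀ {p} → mem p → mem (p ⁻¹ₚ)
open AutSubgroup public

module _ {n : ℕ} {Γ : Graph n} (H : AutSubgroup Γ) where

  IsAbelian : Set
  IsAbelian = ∀ p q → mem H p → mem H q → (p ∘ₚ q) ≈ₚ (q ∘ₚ p)

  IsSemiregular : Set
  IsSemiregular = ∀ p x → mem H p → fwd p x ≡ x → p ≈ₚ idₚ

  InOrbit : Fin n → Fin n → Set
  InOrbit x y = Σ (Perm n) λ p → mem H p × (fwd p x ≡ y)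

  -- Γ is bipartite and the H-orbits are exactly the two bipartite sets:
  -- H has exactly two orbits (those of a and b) and no edge of Γ lies
  -- inside an orbit.
  OrbitsAreBipartition : Set
  OrbitsAreBipartition =
    Σ (Fin n) λ a → Σ (Fin n) λ b →
      ¬ InOrbit a b
      × (∀ x → InOrbit a x ⊎ InOrbit b x)
      × (∀ x y → Graph.adj Γ x y ≡ true → ¬ InOrbit x y)

  -- The generalized dihedral group GD_H = H ⋊ Z₂, elements h t^e.

  record GD : Set where
    constructor gd
    field
      el   : Perm n
      inH  : mem H el
      flag : Bool
  open GD public

  _≈ᴳ_ : GD → GD → Set
  g ≈ᴳ g' = (el g ≈ₚ el g') × (flag g ≡ flag g')

  -- (h t^e)(k t^f) = h k^{(-1)^e} t^{e+f}
  _·ᴳ_ : GD → GD → GD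
  gd h hH e ·ᴳ gd k kH f =
    gd (h ∘ₚ (if e then k ⁻¹ₚ else k))
       (mem-∘ H hH (aux e))
       (e xor f)
    where
    aux : ∀ e → mem H (if e then k ⁻¹ₚ else k)
    aux true  = mem-inv H kH
    aux false = kH

  1ᴳ : GD
  1ᴳ = gd idₚ (mem-id H) false

  _⁻¹ᴳ : GD → GD
  gd h hH false ⁻¹ᴳ = gd (h ⁻¹ₚ) (mem-inv H hH) false
  gd h hH true  ⁻¹ᴳ = gd h hH true

  CayAdj : (GD → Set) → GD → GD → Set
  CayAdj S g g' = Σ GD λ s → S s × (g' ≈ᴳ (s ·ᴳ g))

  IsCayleyOnGD : Set₁
  IsCayleyOnGD =
    Σ (GD → Set) λ S →
    Σ (Fin n → GD) λ φ →
        (∀ {g g'} → g ≈ᴳ g' → S g → S g')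
      × ¬ S 1ᴳ
      × (∀ {g} → S g → S (g ⁻¹ᴳ))
      × (∀ x y → φ x ≈ᴳ φ y → x ≡ y)
      × (∀ g → Σ (Fin n) λ x → φ x ≈ᴳ g)
      × (∀ x y → (Graph.adj Γ x y ≡ true → CayAdj S (φ x) (φ y))
                × (CayAdj S (φ x) (φ y) → Graph.adj Γ x y ≡ true))

-- Label the two orbits by GD_H: h ↦ h(a) and h t ↦ h⁻¹(b).  Semiregularity
-- makes this a bijection, and the neighbourhood S of a = vertex 1 is then a
-- set of reflections h t (Γ is bipartite), closed under inversion.  Since H
-- acts by automorphisms and is abelian, adjacency of vertex g and vertex g'
-- depends only on g' g⁻¹, namely on whether g' g⁻¹ ∈ S; this is adjacency in
-- Cay(GD_H, S).
module Submission where

open import Data.Nat using (ℕ)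
open import Data.Fin using (Fin)
open import Data.Bool using (Bool; true; false)
open import Data.Product using (Σ; _,_; proj₁; proj₂)
open import Data.Sum using (_⊎_; inj₁; inj₂)
open import Data.Empty using (⊥-elim)
open import Function.Bundles using (_⇔_; mk⇔; Equivalence)
open import Function.Construct.Composition using (_⇔-∘_)
open import Function.Construct.Symmetry using (⇔-sym)
open import Relation.Nullary using (¬_)
open import Relation.Binary.PropositionalEquality
open import Defs

≈ₚ-bwd : ∀ {n} {p q : Perm n} → p ≈ₚ q → ∀ x → bwd p x ≡ bwd q x
≈ₚ-bwd {p = p} {q} p≈q x =
  trans (sym (left q (bwd p x))) (cong (bwd q) (trans (sym (p≈q (bwd p x))) (right p x)))

∘-⁻¹-cancelʳ : ∀ {n} (p q : Perm n) → ((p ∘ₚ (q ⁻¹ₚ)) ∘ₚ q) ≈ₚ p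
∘-⁻¹-cancelʳ p q x = cong (fwd p) (left q x)

≈ₚ-solveʳ : ∀ {n} {p m q : Perm n} → p ≈ₚ (m ∘ₚ q) → m ≈ₚ (p ∘ₚ (q ⁻¹ₚ))
≈ₚ-solveʳ {m = m} {q} p≈mq x =
  trans (cong (fwd m) (sym (right q x))) (sym (p≈mq (bwd q x)))

IsAut-transpose : ∀ {n} (Γ : Graph n) {p : Perm n} → IsAut Γ p →
                  ∀ x y → Graph.adj Γ (fwd p x) y ≡ Graph.adj Γ x (bwd p y)
IsAut-transpose Γ {p} p-aut x y =
  trans (cong (Graph.adj Γ (fwd p x)) (sym (right p y))) (p-aut x (bwd p y))

≡-true-⇔ : ∀ {u v : Bool} → u ≡ v → (u ≡ true) ⇔ (v ≡ true)
≡-true-⇔ u≡v = mk⇔ (trans (sym u≡v)) (trans u≡v)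

module _ {n : ℕ} {Γ : Graph n} (H : AutSubgroup Γ) where

  private
    _≈_ : GD H → GD H → Set
    _≈_ = _≈ᴳ_ H

    _·_ : GD H → GD H → GD H
    _·_ = _·ᴳ_ H

    _⁻¹ : GD H → GD H
    _⁻¹ = _⁻¹ᴳ H

  quotient-factor : ∀ g g' → g' ≈ ((g' · (g ⁻¹)) · g)
  quotient-factor (gd h _ false) (gd h' _ false) = (λ x → sym (∘-⁻¹-cancelʳ h' h x)) , refl
  quotient-factor (gd h _ false) (gd k _ true)   = (λ x → sym (∘-⁻¹-cancelʳ k (h ⁻¹ₚ) x)) , refl
  quotient-factor (gd k _ true)  (gd h _ false)  = (λ x → sym (∘-⁻¹-cancelʳ h (k ⁻¹ₚ) x)) , refl
  quotient-factor (gd k _ true)  (gd k' _ true)  = (λ x → sym (∘-⁻¹-cancelʳ k' k x)) , refl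

  factor-quotient : ∀ {g g' s} → g' ≈ (s · g) → s ≈ (g' · (g ⁻¹))
  factor-quotient {gd h _ false} {gd p _ _} {gd m _ false} (e , refl) = ≈ₚ-solveʳ {p = p} {m} {h} e , refl
  factor-quotient {gd h _ true}  {gd p _ _} {gd m _ false} (e , refl) = ≈ₚ-solveʳ {p = p} {m} {h} e , refl
  factor-quotient {gd h _ false} {gd p _ _} {gd m _ true}  (e , refl) = ≈ₚ-solveʳ {p = p} {m} {h ⁻¹ₚ} e , refl
  factor-quotient {gd h _ true}  {gd p _ _} {gd m _ true}  (e , refl) = ≈ₚ-solveʳ {p = p} {m} {h ⁻¹ₚ} e , refl

  CayAdj⇔quotient : (S : GD H → Set) → (∀ {g g'} → g ≈ g' → S g → S g') →
                    ∀ g g' → CayAdj H S g g' ⇔ S (g' · (g ⁻¹))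
  CayAdj⇔quotient S S-resp g g' = mk⇔
    (λ (s , s∈S , g'≈sg) → S-resp (factor-quotient {g} {g'} {s} g'≈sg) s∈S)
    (λ q∈S → g' · (g ⁻¹) , q∈S , quotient-factor g g')

  InOrbit-translate : ∀ {p q x} → mem H p → mem H q → InOrbit H (fwd p x) (fwd q x)
  InOrbit-translate {p} {q} {x} p∈H q∈H =
    q ∘ₚ (p ⁻¹ₚ) , mem-∘ H q∈H (mem-inv H p∈H) , cong (fwd q) (left p x)

  module Bipartite
    (abelian : IsAbelian H) (semiregular : IsSemiregular H)
    (a b : Fin n) (a≁b : ¬ InOrbit H a b)
    (orbits : ∀ x → InOrbit H a x ⊎ InOrbit H b x)
    (edge-crosses : ∀ x y → Graph.adj Γ x y ≡ true → ¬ InOrbit H x y)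
    where

    open Graph Γ using (adj)

    agree⇒≈ₚ : ∀ {p q x} → mem H p → mem H q → fwd p x ≡ fwd q x → p ≈ₚ q
    agree⇒≈ₚ {p} {q} {x} p∈H q∈H px≡qx z =
      trans (sym (right q (fwd p z))) (cong (fwd q) (q⁻¹p-trivial z))
      where
      q⁻¹p-trivial : ((q ⁻¹ₚ) ∘ₚ p) ≈ₚ idₚ
      q⁻¹p-trivial = semiregular ((q ⁻¹ₚ) ∘ₚ p) x (mem-∘ H (mem-inv H q∈H) p∈H)
                       (trans (cong (bwd q) px≡qx) (left q x))

    vertex : GD H → Fin n
    vertex (gd h _ false) = fwd h a
    vertex (gd h _ true)  = bwd h b

    vertex-resp : ∀ {g g'} → g ≈ g' → vertex g ≡ vertex g'
    vertex-resp {gd _ _ false} (h≈h' , refl) = h≈h' a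
    vertex-resp {gd h _ true} {gd h' _ true} (h≈h' , refl) = ≈ₚ-bwd {p = h} {h'} h≈h' b

    orbits-disjoint : ∀ {h k} → mem H h → mem H k → fwd h a ≢ bwd k b
    orbits-disjoint {h} {k} h∈H k∈H ha≡k⁻¹b =
      a≁b (k ∘ₚ h , mem-∘ H k∈H h∈H , trans (cong (fwd k) ha≡k⁻¹b) (right k b))

    vertex-injective : ∀ g g' → vertex g ≡ vertex g' → g ≈ g'
    vertex-injective (gd h h∈H false) (gd h' h'∈H false) eq = agree⇒≈ₚ h∈H h'∈H eq , refl
    vertex-injective (gd h h∈H true)  (gd h' h'∈H true)  eq =
      ≈ₚ-bwd {p = h ⁻¹ₚ} {h' ⁻¹ₚ} (agree⇒≈ₚ (mem-inv H h∈H) (mem-inv H h'∈H) eq) , refl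
    vertex-injective (gd h h∈H false) (gd k k∈H true)    eq = ⊥-elim (orbits-disjoint h∈H k∈H eq)
    vertex-injective (gd k k∈H true)  (gd h h∈H false)   eq = ⊥-elim (orbits-disjoint h∈H k∈H (sym eq))

    coordinate : ∀ x → Σ (GD H) λ g → vertex g ≡ x
    coordinate x with orbits x
    ... | inj₁ (h , h∈H , ha≡x) = gd h h∈H false , ha≡x
    ... | inj₂ (k , k∈H , kb≡x) = gd (k ⁻¹ₚ) (mem-inv H k∈H) true , kb≡x

    φ : Fin n → GD H
    φ x = proj₁ (coordinate x)

    vertex-φ : ∀ x → vertex (φ x) ≡ x
    vertex-φ x = proj₂ (coordinate x)

    φ-vertex : ∀ g → φ (vertex g) ≈ g
    φ-vertex g = vertex-injective (φ (vertex g)) g (vertex-φ (vertex g))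

    φ-injective : ∀ {x y} → φ x ≈ φ y → x ≡ y
    φ-injective {x} {y} φx≈φy = trans (sym (vertex-φ x)) (trans (vertex-resp φx≈φy) (vertex-φ y))

    Connection : GD H → Set
    Connection s = adj a (vertex s) ≡ true

    Connection-resp : ∀ {g g'} → g ≈ g' → Connection g → Connection g'
    Connection-resp g≈g' = subst (λ v → adj a v ≡ true) (vertex-resp g≈g')

    rotation∉Connection : ∀ {h} → mem H h → adj a (fwd h a) ≢ true
    rotation∉Connection {h} h∈H a~ha = edge-crosses a (fwd h a) a~ha (h , h∈H , refl)

    1∉Connection : ¬ Connection (1ᴳ H)
    1∉Connection = rotation∉Connection (mem-id H)

    Connection-inv : ∀ {s} → Connection s → Connection (s ⁻¹)
    Connection-inv {gd _ _ true}  s∈S = s∈S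
    Connection-inv {gd h h∈H false} s∈S = ⊥-elim (rotation∉Connection h∈H s∈S)

    adj-vertex⇔Connection : ∀ g g' → (adj (vertex g) (vertex g') ≡ true) ⇔ Connection (g' · (g ⁻¹))
    adj-vertex⇔Connection (gd h h∈H false) (gd h' h'∈H false) = mk⇔
      (λ e → ⊥-elim (edge-crosses _ _ e (InOrbit-translate h∈H h'∈H)))
      (λ q∈S → ⊥-elim (rotation∉Connection (mem-∘ H h'∈H (mem-inv H h∈H)) q∈S))
    adj-vertex⇔Connection (gd k k∈H true) (gd k' k'∈H true) = mk⇔
      (λ e → ⊥-elim (edge-crosses _ _ e (InOrbit-translate (mem-inv H k∈H) (mem-inv H k'∈H))))
      (λ q∈S → ⊥-elim (rotation∉Connection (mem-∘ H k'∈H (mem-inv H k∈H)) q∈S))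
    adj-vertex⇔Connection (gd h h∈H false) (gd k _ true) =
      ≡-true-⇔ (IsAut-transpose Γ {p = h} (mem-aut H h∈H) a (bwd k b))
    adj-vertex⇔Connection (gd k k∈H true) (gd h h∈H false) = ≡-true-⇔ (begin
      adj (bwd k b) (fwd h a)  ≡⟨ Graph.sym Γ _ _ ⟩
      adj (fwd h a) (bwd k b)  ≡⟨ IsAut-transpose Γ {p = h} (mem-aut H h∈H) a (bwd k b) ⟩
      adj a (bwd h (bwd k b))  ≡⟨ cong (adj a) (abelian _ _ (mem-inv H h∈H) (mem-inv H k∈H) b) ⟩
      adj a (bwd k (bwd h b))  ∎)
      where open ≡-Reasoning

    adj⇔CayAdj : ∀ x y → (adj x y ≡ true) ⇔ CayAdj H Connection (φ x) (φ y)
    adj⇔CayAdj x y =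
      subst₂ (λ u v → (adj u v ≡ true) ⇔ CayAdj H Connection (φ x) (φ y)) (vertex-φ x) (vertex-φ y)
        (⇔-sym (CayAdj⇔quotient Connection Connection-resp (φ x) (φ y))
           ⇔-∘ adj-vertex⇔Connection (φ x) (φ y))

lemma2p8 : {n : ℕ} (Γ : Graph n) (H : AutSubgroup Γ) →
    IsAbelian H → IsSemiregular H → OrbitsAreBipartition H →
    IsCayleyOnGD H
lemma2p8 Γ H abelian semiregular (a , b , a≁b , orbits , edge-crosses) =
    Connection , φ , (λ {g} {g'} → Connection-resp {g} {g'}) , 1∉Connection
  , (λ {g} → Connection-inv {g})
  , (λ x y → φ-injective) , (λ g → vertex g , φ-vertex g)
  , (λ x y → Equivalence.to (adj⇔CayAdj x y) , Equivalence.from (adj⇔CayAdj x y))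
  where open Bipartite H abelian semiregular a b a≁b orbits edge-crosses
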